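{- Let $\mathcal X$ be a reduced Klein configuration with fiber index set $I$ such that for every $i\in I$ there exists $j\in I\setminus\{i\}$ with $R_{ji}\ne G$. Then the incidence structure $\mathcal G=(I,L)$ is a partial linear space (every line has at least two points and two distinct points lie on at most one common line) in which every point is incident to at most three lines.
   Context: Let $G$ be a Klein four-group. A coherent configuration is a pair $(\Omega,S)$ with $\Omega$ finite and $S$ a partition of $\Omega\times\Omega$ such that $1_\Omega$ is a union of elements of $S$, $S$ is closed under transposition, and for $u,v,w\in S$ the number $|\alpha u\cap\gamma v^*|$ is independent of $(\alpha,\gamma)\in w$. Fibers are the sets $\Delta$ with $1_\Delta\in S$. A Klein configuration is a coherent configuration in which the restriction to each fiber $\Delta$ (basic relations contained in $\Delta\times\Delta$) is the orbit scheme of a regular permutation group on $\Delta$ isomorphic to $G$. Write the fibers as $\Omega_i$, $i\in I$, $S_{ij}=\{s\in S: s\subseteq\Omega_i\times\Omega_j\}$; $S_{ii}$ is a group under relational product $\cdot$ isomorphic to $G$, and group isomorphisms $G\to S_{ii}$, $g\mapsto g_i$, are fixed. Set $R_{ij}=\{g\in G:s\cdot g_j=s\}$, which does not depend on $s\in S_{ij}$. The configuration is reduced if $R_{ij}\ne\{1\}$ for all distinct $i,j\in I$. The incidence structure $\mathcal G=(I,L)$ has point set $I$ and line set $L$ consisting of all sets $L_i(H)=\{i\}\cup\{j\in I:R_{ji}=H\}$, where $i\in I$ and $H$ is a subgroup of $G$ of order $2$ with $H=R_{ji}$ for some $j\in I\setminus\{i\}$. -}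

module Defs where

open import Data.Nat using (ℕ)
open import Data.Fin using (Fin; _≟_)
open import Data.Fin.Properties using ()
open import Data.List using (List; length; filter)
open import Data.List using () renaming (_∷_ to _∷ₗ_)
open import Data.Fin.Base using ()
open import Data.List.Base using ()
open import Data.Product using (Σ; ∃; ∃-syntax; _×_; _,_)
open import Data.Sum using (_⊎_)
open import Relation.Nullary using (¬_)
open import Relation.Nullary.Decidable using (_×-dec_)
open import Relation.Binary.PropositionalEquality using (_≡_; _≢_)
open import Function.Bundles using (_⇔_)
import Data.List.Base as L
import Data.Fin.Base as F

data V4 : Set where
  e a b ab : V4

infixl 7 _·_
_·_ : V4 → V4 → V4
e  · y  = y
x  · e  = x
a  · a  = e
a  · b  = ab
a  · ab = b
b  · a  = ab
b  · b  = e
b  · ab = a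
ab · a  = b
ab · b  = a
ab · ab = e

-- The partition S of Ω × Ω into
-- r classes is given by a surjective colouring col : Ω → Ω → Fin r;
-- the basic relation with colour u is {(x,y) | col x y ≡ u}.

module _ {n r : ℕ} (col : Fin n → Fin n → Fin r) where

  interNum : Fin r → Fin r → Fin n → Fin n → ℕ
  interNum u v α γ =
    length (filter (λ β → (col α β ≟ u) ×-dec (col β γ ≟ v)) (L.allFin n))

  record IsCoherent : Set where
    field
      nonempty : ∀ u → ∃[ x ] ∃[ y ] col x y ≡ u
      -- 1_Ω is a union of classes
      diagUnion : ∀ x y z → col x x ≡ col y z → y ≡ z
      transp : ∀ u → ∃[ u' ] (∀ x y → (col x y ≡ u) ⇔ (col y x ≡ u'))
      interConst : ∀ u v w α γ α' γ' → col α γ ≡ w → col α' γ' ≡ w →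
                   interNum u v α γ ≡ interNum u v α' γ'

  -- k is (the colour of) 1_Δ for a fiber Δ
  IsFiber : Fin r → Set
  IsFiber k = (∃[ x ] col x x ≡ k) × (∀ y z → col y z ≡ k → y ≡ z)

  InFiber : Fin r → Fin n → Set
  InFiber k x = col x x ≡ k

  InS : Fin r → Fin r → Fin r → Set
  InS i j s = ∀ x y → col x y ≡ s → InFiber i x × InFiber j y

  ProdIs : Fin r → Fin r → Fin r → Set
  ProdIs s t u = ∀ α γ → (∃[ β ] (col α β ≡ s × col β γ ≡ t)) ⇔ (col α γ ≡ u)

  -- restriction to the fiber Ω_k is the orbit scheme of a regular
  -- permutation group on Ω_k isomorphic to G (given as a regular action of G)
  IsKleinFiber : Fin r → Set
  IsKleinFiber k = Σ (V4 → Fin n → Fin n) λ act →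
      (∀ g x → InFiber k x → InFiber k (act g x))
    × (∀ x → InFiber k x → act e x ≡ x)
    × (∀ g h x → InFiber k x → act (g · h) x ≡ act g (act h x))
    × (∀ x y → InFiber k x → InFiber k y →
         ∃[ g ] (act g x ≡ y × (∀ h → act h x ≡ y → h ≡ g)))
    × (∀ x y x' y' → InFiber k x → InFiber k y → InFiber k x' → InFiber k y' →
         (col x y ≡ col x' y') ⇔ (∃[ g ] (act g x ≡ x' × act g y ≡ y')))

  record IsKleinConfiguration : Set where
    field
      coherent : IsCoherent
      klein    : ∀ k → IsFiber k → IsKleinFiber k

  -- φ k : G → S_kk, g ↦ g_k, is a group isomorphism for every fiber k
  IsIdentification : (Fin r → V4 → Fin r) → Set
  IsIdentification φ = ∀ k → IsFiber k →
      (∀ g → InS k k (φ k g))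
    × (∀ g h → φ k g ≡ φ k h → g ≡ h)
    × (∀ s → InS k k s → ∃[ g ] φ k g ≡ s)
    × (∀ g h → ProdIs (φ k g) (φ k h) (φ k (g · h)))

  module _ (φ : Fin r → V4 → Fin r) where

    R : Fin r → Fin r → V4 → Set
    R i j g = ∀ s → InS i j s → ProdIs s (φ j g) s

    RIsOrd2 : Fin r → Fin r → V4 → Set
    RIsOrd2 i j h = ∀ g → R i j g ⇔ (g ≡ e ⊎ g ≡ h)

    Reduced : Set
    Reduced = ∀ i j → IsFiber i → IsFiber j → i ≢ j →
              ¬ (∀ g → R i j g ⇔ (g ≡ e))

    record Line : Set where
      field
        base  : Fin r
        gen   : V4
        baseF : IsFiber base
        gen≢e : gen ≢ e
        witness : ∃[ j ] (IsFiber j × j ≢ base × RIsOrd2 j base gen)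

    OnLine : Fin r → Line → Set
    OnLine p ℓ = p ≡ Line.base ℓ ⊎ RIsOrd2 p (Line.base ℓ) (Line.gen ℓ)

    SameLine : Line → Line → Set
    SameLine ℓ ℓ' = ∀ q → IsFiber q → OnLine q ℓ ⇔ OnLine q ℓ'

module Submission where

-- Inside a fibre Ω_k the relation g_k is the graph of the permutation x ↦ g x,
-- and g ∈ R_ij says that moving the second point of a pair in Ω_i × Ω_j along
-- g_j never changes its colour ('Fixes').  Hence R_ij is a subgroup of G, and
-- R_ij = G forces S_ij = {Ω_i × Ω_j}, so R_ji = G as well.  In a reduced
-- configuration R_ji = {e,h} thus gives |R_ij| = 2 ('order2-transpose').
-- The key geometric step ('neighbourhood') says that when R_ki = {e,h} the
-- points of Ω_i in a given colour from z ∈ Ω_k form one R_ki-orbit.  From it,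
-- R_ji = R_ki = {e,h} and R_ij = {e,h'} give R_kj = {e,h'} ('order2-propagates'),
-- so a line L_i(H) through p equals L_p(H') for some H' ('lineAt').  Since
-- q ∈ L_p(H') determines H' = R_qp, two points lie on at most one line, and a
-- point p lies on at most the three lines L_p(H), H ≠ {e}.

open import Defs
open import Data.Nat using (ℕ; s≤s; z≤n)
open import Data.Fin using (Fin; _≟_) renaming (zero to fzero; suc to fsuc)
import Data.Fin.Properties as FinP
open import Data.List using (List; length; filter; []; _∷_)
import Data.List.Base as L
open import Data.List.Relation.Unary.Any using (here; there)
open import Data.List.Membership.Propositional using (_∈_)
open import Data.List.Membership.Propositional.Properties using (∈-allFin; ∈-filter⁺; ∈-filter⁻)
open import Data.Product using (∃-syntax; _×_; _,_; proj₁; proj₂)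
open import Data.Sum using (_⊎_; inj₁; inj₂; [_,_]′)
open import Data.Empty using (⊥-elim)
open import Function using (id)
open import Function.Bundles using (_⇔_; mk⇔; Equivalence)
open import Relation.Nullary using (¬_; Dec; yes; no)
open import Relation.Nullary.Decidable using (_×-dec_; _→-dec_)
open import Relation.Binary.PropositionalEquality
  using (_≡_; _≢_; refl; sym; trans; cong; subst; ≢-sym)

open Equivalence using (to; from)

_≟V_ : (x y : V4) → Dec (x ≡ y)
e  ≟V e  = yes refl
e  ≟V a  = no λ ()
e  ≟V b  = no λ ()
e  ≟V ab = no λ ()
a  ≟V e  = no λ ()
a  ≟V a  = yes refl
a  ≟V b  = no λ ()
a  ≟V ab = no λ ()
b  ≟V e  = no λ ()
b  ≟V a  = no λ ()
b  ≟V b  = yes refl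
b  ≟V ab = no λ ()
ab ≟V e  = no λ ()
ab ≟V a  = no λ ()
ab ≟V b  = no λ ()
ab ≟V ab = yes refl

square : ∀ g → g · g ≡ e
square e  = refl
square a  = refl
square b  = refl
square ab = refl

idempotent⇒e : ∀ d → d ≡ d · d → d ≡ e
idempotent⇒e e  _ = refl
idempotent⇒e a  ()
idempotent⇒e b  ()
idempotent⇒e ab ()

outside : ∀ h → ∃[ g ] (g ≢ e × g ≢ h)
outside e  = a , (λ ()) , (λ ())
outside a  = b , (λ ()) , (λ ())
outside b  = a , (λ ()) , (λ ())
outside ab = a , (λ ()) , (λ ())

cover : ∀ h d → h ≢ e → d ≢ e → d ≢ h → ∀ g → g ≡ e ⊎ g ≡ h ⊎ g ≡ d ⊎ g ≡ d · h
cover h d h≢e d≢e d≢h e = inj₁ refl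
cover e d h≢e d≢e d≢h g = ⊥-elim (h≢e refl)
cover h e h≢e d≢e d≢h g = ⊥-elim (d≢e refl)
cover a a h≢e d≢e d≢h g = ⊥-elim (d≢h refl)
cover b b h≢e d≢e d≢h g = ⊥-elim (d≢h refl)
cover ab ab h≢e d≢e d≢h g = ⊥-elim (d≢h refl)
cover a b _ _ _ a = inj₂ (inj₁ refl)
cover a b _ _ _ b = inj₂ (inj₂ (inj₁ refl))
cover a b _ _ _ ab = inj₂ (inj₂ (inj₂ refl))
cover a ab _ _ _ a = inj₂ (inj₁ refl)
cover a ab _ _ _ b = inj₂ (inj₂ (inj₂ refl))
cover a ab _ _ _ ab = inj₂ (inj₂ (inj₁ refl))
cover b a _ _ _ a = inj₂ (inj₂ (inj₁ refl))
cover b a _ _ _ b = inj₂ (inj₁ refl)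
cover b a _ _ _ ab = inj₂ (inj₂ (inj₂ refl))
cover b ab _ _ _ a = inj₂ (inj₂ (inj₂ refl))
cover b ab _ _ _ b = inj₂ (inj₁ refl)
cover b ab _ _ _ ab = inj₂ (inj₂ (inj₁ refl))
cover ab a _ _ _ a = inj₂ (inj₂ (inj₁ refl))
cover ab a _ _ _ b = inj₂ (inj₂ (inj₂ refl))
cover ab a _ _ _ ab = inj₂ (inj₁ refl)
cover ab b _ _ _ a = inj₂ (inj₂ (inj₂ refl))
cover ab b _ _ _ b = inj₂ (inj₂ (inj₁ refl))
cover ab b _ _ _ ab = inj₂ (inj₁ refl)

uniqueGenerator : ∀ {P : V4 → Set} {h h'} → h' ≢ e →
                  (∀ g → P g ⇔ (g ≡ e ⊎ g ≡ h)) → (∀ g → P g ⇔ (g ≡ e ⊎ g ≡ h')) → h ≡ h'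
uniqueGenerator {h' = h'} h'≢e P≡⟨h⟩ P≡⟨h'⟩ with to (P≡⟨h⟩ h') (from (P≡⟨h'⟩ h') (inj₂ refl))
... | inj₁ h'≡e = ⊥-elim (h'≢e h'≡e)
... | inj₂ h'≡h = sym h'≡h

nonIdentityIndex : V4 → Fin 3
nonIdentityIndex e  = fzero
nonIdentityIndex a  = fzero
nonIdentityIndex b  = fsuc fzero
nonIdentityIndex ab = fsuc (fsuc fzero)

nonIdentityIndex-injective : ∀ x y → x ≢ e → y ≢ e → nonIdentityIndex x ≡ nonIdentityIndex y → x ≡ y
nonIdentityIndex-injective e  _  x≢e _   _  = ⊥-elim (x≢e refl)
nonIdentityIndex-injective _  e  _   y≢e _  = ⊥-elim (y≢e refl)
nonIdentityIndex-injective a  a  _   _   _  = refl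
nonIdentityIndex-injective b  b  _   _   _  = refl
nonIdentityIndex-injective ab ab _   _   _  = refl
nonIdentityIndex-injective a  b  _   _   ()
nonIdentityIndex-injective a  ab _   _   ()
nonIdentityIndex-injective b  a  _   _   ()
nonIdentityIndex-injective b  ab _   _   ()
nonIdentityIndex-injective ab a  _   _   ()
nonIdentityIndex-injective ab b  _   _   ()

repeatedNonIdentity : (hs : Fin 4 → V4) → (∀ k → hs k ≢ e) → ∃[ x ] ∃[ y ] (x ≢ y × hs x ≡ hs y)
repeatedNonIdentity hs hs≢e
  with FinP.pigeonhole (s≤s (s≤s (s≤s (s≤s z≤n)))) (λ k → nonIdentityIndex (hs k))
... | x , y , x<y , same =
  x , y , FinP.<⇒≢ x<y , nonIdentityIndex-injective _ _ (hs≢e x) (hs≢e y) same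

module Subgroup (P : V4 → Set) (P? : ∀ g → Dec (P g)) (P-e : P e)
                (P-· : ∀ g h → P g → P h → P (g · h)) where

  nonIdentity : ¬ (∀ g → P g ⇔ (g ≡ e)) → ∃[ h ] (h ≢ e × P h)
  nonIdentity nontrivial with P? a | P? b | P? ab
  ... | yes Pa | _      | _       = a , (λ ()) , Pa
  ... | no _   | yes Pb | _       = b , (λ ()) , Pb
  ... | no _   | no _   | yes Pab = ab , (λ ()) , Pab
  ... | no ¬Pa | no ¬Pb | no ¬Pab = ⊥-elim (nontrivial λ
        { e  → mk⇔ (λ _ → refl) (λ _ → P-e)
        ; a  → mk⇔ (λ Pa → ⊥-elim (¬Pa Pa)) (λ ())
        ; b  → mk⇔ (λ Pb → ⊥-elim (¬Pb Pb)) (λ ())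
        ; ab → mk⇔ (λ Pab → ⊥-elim (¬Pab Pab)) (λ ()) })

  generatedBy : ∀ {h} → h ≢ e → P h → ¬ (∀ g → P g) → ∀ g → P g ⇔ (g ≡ e ⊎ g ≡ h)
  generatedBy {h} h≢e Ph proper g = mk⇔ inside (λ { (inj₁ refl) → P-e ; (inj₂ refl) → Ph })
    where
      inside : P g → g ≡ e ⊎ g ≡ h
      inside Pg with g ≟V e | g ≟V h
      ... | yes g≡e | _       = inj₁ g≡e
      ... | no _    | yes g≡h = inj₂ g≡h
      ... | no g≢e  | no g≢h  = ⊥-elim (proper λ g' → member (cover h g h≢e g≢e g≢h g'))
        where
          member : ∀ {g'} → g' ≡ e ⊎ g' ≡ h ⊎ g' ≡ g ⊎ g' ≡ g · h → P g'
          member (inj₁ refl)               = P-e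
          member (inj₂ (inj₁ refl))        = Ph
          member (inj₂ (inj₂ (inj₁ refl))) = Pg
          member (inj₂ (inj₂ (inj₂ refl))) = P-· g h Pg Ph

  order2 : ¬ (∀ g → P g) → ¬ (∀ g → P g ⇔ (g ≡ e)) →
           ∃[ h ] (h ≢ e × (∀ g → P g ⇔ (g ≡ e ⊎ g ≡ h)))
  order2 proper nontrivial with nonIdentity nontrivial
  ... | h , h≢e , Ph = h , h≢e , generatedBy h≢e Ph proper

  squeeze : ∀ {h} → (∀ g → P g → g ≡ e ⊎ g ≡ h) → ¬ (∀ g → P g ⇔ (g ≡ e)) →
            ∀ g → P g ⇔ (g ≡ e ⊎ g ≡ h)
  squeeze {h} P⊆⟨h⟩ nontrivial with nonIdentity nontrivial
  ... | h'' , h''≢e , Ph'' with P⊆⟨h⟩ h'' Ph''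
  ...   | inj₁ h''≡e = ⊥-elim (h''≢e h''≡e)
  ...   | inj₂ refl  = λ g → mk⇔ (P⊆⟨h⟩ g) (λ { (inj₁ refl) → P-e ; (inj₂ refl) → Ph'' })

∈⇒length≢0 : ∀ {A : Set} {x : A} {xs : List A} → x ∈ xs → length xs ≢ 0
∈⇒length≢0 (here _)  ()
∈⇒length≢0 (there _) ()

length≢0⇒∈ : ∀ {A : Set} (xs : List A) → length xs ≢ 0 → ∃[ x ] x ∈ xs
length≢0⇒∈ []      length≢0 = ⊥-elim (length≢0 refl)
length≢0⇒∈ (x ∷ _) _        = x , here refl

module Coherent {n r : ℕ} {col : Fin n → Fin n → Fin r} (C : IsCoherent col) where
  open IsCoherent C

  -- Intersection numbers depend only on the colour of (α, γ), so a path
  -- α →u β →v γ can be transported to every pair (α', γ') of that colour.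
  transfer : ∀ {α β γ α' γ' u v} → col α γ ≡ col α' γ' → col α β ≡ u → col β γ ≡ v →
             ∃[ β' ] (col α' β' ≡ u × col β' γ' ≡ v)
  transfer {α} {β} {γ} {α'} {γ'} {u} {v} same αβ βγ =
    let β' , β'∈ = length≢0⇒∈ (filter (path? α' γ') (L.allFin n)) count'≢0
    in β' , proj₂ (∈-filter⁻ (path? α' γ') {xs = L.allFin n} β'∈)
    where
      path? : ∀ x z y → Dec (col x y ≡ u × col y z ≡ v)
      path? x z y = (col x y ≟ u) ×-dec (col y z ≟ v)
      count'≢0 : interNum col u v α' γ' ≢ 0
      count'≢0 zero = ∈⇒length≢0 (∈-filter⁺ (path? α γ) (∈-allFin β) (αβ , βγ))
        (trans (interConst u v (col α γ) α γ α' γ' refl (sym same)) zero)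

  sameFibres : ∀ {x y x' y'} → col x y ≡ col x' y' →
               col x x ≡ col x' x' × col y y ≡ col y' y'
  sameFibres {x} {y} {x'} {y'} same
    with transfer {β = x} same refl refl | transfer {β = y} same refl refl
  ... | β , x'β≡xx , _ | β' , _ , β'y'≡yy
    with diagUnion x x' β (sym x'β≡xx) | diagUnion y β' y' (sym β'y'≡yy)
  ... | refl | refl = sym x'β≡xx , sym β'y'≡yy

  transpose : ∀ {x y x' y'} → col x y ≡ col x' y' → col y x ≡ col y' x'
  transpose {x} {y} {x'} {y'} same with transp (col x y)
  ... | _ , swapped = trans (to (swapped x y) refl) (sym (to (swapped x' y') (sym same)))

  colourInS : ∀ {i j x y} → col x x ≡ i → col y y ≡ j → InS col i j (col x y)
  colourInS x∈ y∈ u w uw = trans (proj₁ (sameFibres uw)) x∈ , trans (proj₂ (sameFibres uw)) y∈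

-- Inside a fibre Ω_k, the thin relation g_k = φ k g is the graph of the
-- permutation x ↦ g x; hypotheses named x→y stand for col x y ≡ φ k g.
module Thin {n r : ℕ} {col : Fin n → Fin n → Fin r} (C : IsCoherent col)
            {φ : Fin r → V4 → Fin r} (Id : IsIdentification col φ)
            (k : Fin r) (kF : IsFiber col k) where
  open IsCoherent C
  open Coherent C

  φ-inS : ∀ g → InS col k k (φ k g)
  φ-inS = proj₁ (Id k kF)

  φ-injective : ∀ g h → φ k g ≡ φ k h → g ≡ h
  φ-injective = proj₁ (proj₂ (Id k kF))

  φ-onto : ∀ s → InS col k k s → ∃[ g ] φ k g ≡ s
  φ-onto = proj₁ (proj₂ (proj₂ (Id k kF)))

  φ-product : ∀ g h → ProdIs col (φ k g) (φ k h) (φ k (g · h))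
  φ-product = proj₂ (proj₂ (proj₂ (Id k kF)))

  -- e_k = 1_{Ω_k}: the identity of S_kk is the only idempotent.
  φ-e : φ k e ≡ k
  φ-e with proj₁ kF
  ... | x , x∈ with φ-onto k (subst (InS col k k) x∈ (colourInS x∈ x∈))
  ...   | d , φd≡k = subst (λ g → φ k g ≡ k) (idempotent⇒e d d≡d·d) φd≡k
    where
      loop : col x x ≡ φ k d
      loop = trans x∈ (sym φd≡k)
      d≡d·d : d ≡ d · d
      d≡d·d = φ-injective d (d · d)
                (trans (sym loop) (to (φ-product d d x x) (x , loop , loop)))

  target : ∀ {x y g} → col x y ≡ φ k g → col y y ≡ k
  target {x} {y} {g} x→y = proj₂ (φ-inS g x y x→y)

  compose : ∀ {x y z g h} → col x y ≡ φ k g → col y z ≡ φ k h → col x z ≡ φ k (g · h)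
  compose {x} {y} {z} {g} {h} x→y y→z = to (φ-product g h x z) (y , x→y , y→z)

  image : ∀ {x} g → col x x ≡ k → ∃[ y ] col x y ≡ φ k g
  image {x} g x∈ with from (φ-product g g x x) (trans x∈ (sym (trans (cong (φ k) (square g)) φ-e)))
  ... | y , x→y , _ = y , x→y

  identity : ∀ {x y} → col x y ≡ φ k e → x ≡ y
  identity {x} {y} x→y = diagUnion x x y (trans (proj₁ (φ-inS e x y x→y)) (trans (sym φ-e) (sym x→y)))

  -- g_k is symmetric, because g = g⁻¹.
  symmetric : ∀ {x y g} → col x y ≡ φ k g → col y x ≡ φ k g
  symmetric {x} {y} {g} x→y with image g (target x→y)
  ... | z , y→z with identity (subst (λ h → col x z ≡ φ k h) (square g) (compose x→y y→z))
  ...   | refl = y→z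

  functional : ∀ {x y y' g} → col x y ≡ φ k g → col x y' ≡ φ k g → y ≡ y'
  functional {g = g} x→y x→y' =
    identity (subst (λ h → _ ≡ φ k h) (square g) (compose (symmetric x→y) x→y'))

  connect : ∀ {x y} → col x x ≡ k → col y y ≡ k → ∃[ g ] col x y ≡ φ k g
  connect x∈ y∈ with φ-onto _ (colourInS x∈ y∈)
  ... | g , φg≡xy = g , sym φg≡xy

module Configuration {n r : ℕ} {col : Fin n → Fin n → Fin r} (C : IsCoherent col)
                     {φ : Fin r → V4 → Fin r} (Id : IsIdentification col φ) where
  open IsCoherent C
  open Coherent C
  module T = Thin C Id

  -- g ∈ R_ij read pointwise: moving the second point of a pair in Ω_i × Ω_j
  -- along g_j does not change the colour of the pair.
  Fixes : Fin r → Fin r → V4 → Set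
  Fixes i j g = ∀ x y y' → col x x ≡ i → col y y ≡ j → col y y' ≡ φ j g → col x y' ≡ col x y

  R⇒Fixes : ∀ {i j g} → R col φ i j g → Fixes i j g
  R⇒Fixes g∈R x y y' x∈ y∈ y→y' = to (g∈R (col x y) (colourInS x∈ y∈) x y') (y , refl , y→y')

  Fixes⇒R : ∀ {i j g} → IsFiber col j → Fixes i j g → R col φ i j g
  Fixes⇒R {j = j} {g} jF fixes s s∈S α γ = mk⇔
    (λ { (β , αβ , β→γ) → trans (fixes α β γ (proj₁ (s∈S α β αβ)) (proj₂ (s∈S α β αβ)) β→γ) αβ })
    (λ αγ → let γ∈ = proj₂ (s∈S α γ αγ)
                β , γ→β = T.image j jF g γ∈
            in β , trans (fixes α γ β (proj₁ (s∈S α γ αγ)) γ∈ γ→β) αγ , T.symmetric j jF γ→β)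

  fixes-e : ∀ {i j} → IsFiber col j → Fixes i j e
  fixes-e jF x y y' _ _ y→y' with T.identity _ jF y→y'
  ... | refl = refl

  fixes-· : ∀ {i j g h} → IsFiber col j → Fixes i j g → Fixes i j h → Fixes i j (g · h)
  fixes-· {j = j} {g} {h} jF fixes-g fixes-h x y y'' x∈ y∈ y→y''
    with from (T.φ-product j jF g h y y'') y→y''
  ... | y' , y→y' , y'→y'' = trans (fixes-h x y' y'' x∈ (T.target j jF y→y') y'→y'')
                                   (fixes-g x y y' x∈ y∈ y→y')

  fixes? : ∀ i j g → Dec (Fixes i j g)
  fixes? i j g = FinP.all? λ x → FinP.all? λ y → FinP.all? λ y' →
    (col x x ≟ i) →-dec ((col y y ≟ j) →-dec ((col y y' ≟ φ j g) →-dec (col x y' ≟ col x y)))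

  R? : ∀ i j g → IsFiber col j → Dec (R col φ i j g)
  R? i j g jF with fixes? i j g
  ... | yes fixes = yes (Fixes⇒R jF fixes)
  ... | no ¬fixes = no λ g∈R → ¬fixes (R⇒Fixes g∈R)

  module RSubgroup (i j : Fin r) (jF : IsFiber col j) = Subgroup (R col φ i j)
    (λ g → R? i j g jF)
    (Fixes⇒R jF (fixes-e jF))
    (λ g h g∈R h∈R → Fixes⇒R jF (fixes-· jF (R⇒Fixes g∈R) (R⇒Fixes h∈R)))

  Complete : Fin r → Fin r → Set
  Complete i j = ∀ x x' y y' → col x x ≡ i → col x' x' ≡ i → col y y ≡ j → col y' y' ≡ j →
                 col x y ≡ col x' y'

  complete-transpose : ∀ {i j} → Complete i j → Complete j i
  complete-transpose complete y y' x x' y∈ y'∈ x∈ x'∈ = transpose (complete x x' y y' x∈ x'∈ y∈ y'∈)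

  complete⇒Fixes : ∀ {i j g} → IsFiber col j → Complete i j → Fixes i j g
  complete⇒Fixes {j = j} jF complete x y y' x∈ y∈ y→y' =
    complete x x y' y x∈ x∈ (T.target j jF y→y') y∈

  rowConstant⇒complete : ∀ {i j z} → IsFiber col j → col z z ≡ i →
    (∀ y y' → col y y ≡ j → col y' y' ≡ j → col z y ≡ col z y') → Complete i j
  rowConstant⇒complete {i} {j} {z} jF z∈ row x x' y y' x∈ x'∈ y∈ y'∈ =
    trans (sameAsRow x∈ y∈) (sym (sameAsRow x'∈ y'∈))
    where
      y₀ : Fin n
      y₀ = proj₁ (proj₁ jF)
      y₀∈ : col y₀ y₀ ≡ j
      y₀∈ = proj₂ (proj₁ jF)
      -- If β has colour zy₀ from x, so does its g-image y: transport the path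
      -- z → y₀g → y₀ (both z-colours equal by row-constancy) to the pair (x, β).
      moveAlong : ∀ {x β y g} → col x β ≡ col z y₀ → col β y ≡ φ j g → col x y ≡ col z y₀
      moveAlong {x} {β} {y} {g} xβ≡zy₀ β→y =
        let y₁ , y₀→y₁ = T.image j jF g y₀∈
            β' , xβ'≡zy₀ , β'→β = transfer (sym xβ≡zy₀) (row y₁ y₀ (T.target j jF y₀→y₁) y₀∈)
                                                     (T.symmetric j jF y₀→y₁)
        in subst (λ w → col x w ≡ col z y₀)
                 (sym (T.functional j jF β→y (T.symmetric j jF β'→β))) xβ'≡zy₀
      sameAsRow : ∀ {x y} → col x x ≡ i → col y y ≡ j → col x y ≡ col z y₀
      sameAsRow {x} {y} x∈ y∈ =
        let β , xβ≡zy₀ , _ = transfer {β = y₀} (trans z∈ (sym x∈)) refl refl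
            g , β→y = T.connect j jF (trans (proj₂ (sameFibres xβ≡zy₀)) y₀∈) y∈
        in moveAlong xβ≡zy₀ β→y

  full⇒complete : ∀ {i j} → IsFiber col i → IsFiber col j → (∀ g → R col φ i j g) → Complete i j
  full⇒complete {i} {j} iF jF full = rowConstant⇒complete jF z∈ row
    where
      z : Fin n
      z = proj₁ (proj₁ iF)
      z∈ : col z z ≡ i
      z∈ = proj₂ (proj₁ iF)
      row : ∀ y y' → col y y ≡ j → col y' y' ≡ j → col z y ≡ col z y'
      row y y' y∈ y'∈ with T.connect j jF y∈ y'∈
      ... | g , y→y' = sym (R⇒Fixes (full g) z y y' z∈ y∈ y→y')

  -- If R_ji = {e, h} then R_ij ≠ G: otherwise S_ji = {Ω_j × Ω_i} and R_ji = G.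
  order2⇒notFull : ∀ {i j h} → IsFiber col i → IsFiber col j → RIsOrd2 col φ j i h →
                   ¬ (∀ g → R col φ i j g)
  order2⇒notFull {i} {j} {h} iF jF R≡⟨h⟩ full =
    let g , g≢e , g≢h = outside h in [ g≢e , g≢h ]′ (to (R≡⟨h⟩ g) (Fixes⇒R iF (ji-fixes g)))
    where
      ji-fixes : ∀ g → Fixes j i g
      ji-fixes g = complete⇒Fixes iF (complete-transpose (full⇒complete iF jF full))

  order2-transpose : ∀ {i j h} → Reduced col φ → IsFiber col i → IsFiber col j → i ≢ j →
                     RIsOrd2 col φ j i h → ∃[ h' ] (h' ≢ e × RIsOrd2 col φ i j h')
  order2-transpose {i} {j} reduced iF jF i≢j R≡⟨h⟩ =
    RSubgroup.order2 i j jF (order2⇒notFull iF jF R≡⟨h⟩) (reduced i j iF jF i≢j)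

  -- If R_ki = {e, h}, the points of Ω_i in one colour from z ∈ Ω_k form an
  -- R_ki-orbit: x and its d-image have the same colour from z only if d ∈ R_ki.
  -- Otherwise G = {e, h, d, dh} would make z's row constant, so R_ki = G.
  neighbourhood : ∀ {i k h z x x' d} → IsFiber col i → IsFiber col k → h ≢ e →
                  RIsOrd2 col φ k i h → col z z ≡ k → col x x ≡ i →
                  col x x' ≡ φ i d → col z x ≡ col z x' → d ≡ e ⊎ d ≡ h
  neighbourhood {i} {k} {h} {z} {x} {x'} {d} iF kF h≢e R≡⟨h⟩ z∈ x∈ x→x' zx≡zx'
    with d ≟V e | d ≟V h
  ... | yes d≡e | _       = inj₁ d≡e
  ... | no _    | yes d≡h = inj₂ d≡h
  ... | no d≢e  | no d≢h  =
    to (R≡⟨h⟩ d) (Fixes⇒R iF (complete⇒Fixes iF (rowConstant⇒complete iF z∈ row)))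
    where
      open T i iF using (connect; identity; functional; target; φ-product)
      h-fixes : Fixes k i h
      h-fixes = R⇒Fixes (from (R≡⟨h⟩ h) (inj₂ refl))
      -- Every g ∈ G = {e, h, d, dh} moves x to a point of the same colour from z:
      -- x' = d x has it by assumption, and h ∈ R_ki preserves it.
      sameColour : ∀ {g x''} → col x x'' ≡ φ i g → g ≡ e ⊎ g ≡ h ⊎ g ≡ d ⊎ g ≡ d · h →
                   col z x'' ≡ col z x
      sameColour x→x'' (inj₁ refl) = cong (col z) (sym (identity x→x''))
      sameColour x→x'' (inj₂ (inj₁ refl)) = h-fixes z x _ z∈ x∈ x→x''
      sameColour x→x'' (inj₂ (inj₂ (inj₁ refl))) =
        trans (cong (col z) (sym (functional x→x' x→x''))) (sym zx≡zx')
      sameColour {x'' = x''} x→x'' (inj₂ (inj₂ (inj₂ refl))) =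
        let m , x→m , m→x'' = from (φ-product d h x x'') x→x''
        in trans (h-fixes z m x'' z∈ (target x→m) m→x'')
                 (trans (cong (col z) (sym (functional x→x' x→m))) (sym zx≡zx'))
      sameAsX : ∀ {x''} → col x'' x'' ≡ i → col z x'' ≡ col z x
      sameAsX x''∈ = let g , x→x'' = connect x∈ x''∈ in sameColour x→x'' (cover h d h≢e d≢e d≢h g)
      row : ∀ y y' → col y y ≡ i → col y' y' ≡ i → col z y ≡ col z y'
      row y y' y∈ y'∈ = trans (sameAsX y∈) (sym (sameAsX y'∈))

  fixes-transfer : ∀ {i j k h g} → IsFiber col i → IsFiber col j → IsFiber col k → h ≢ e →
                   RIsOrd2 col φ j i h → RIsOrd2 col φ k i h → Fixes k j g → Fixes i j g
  fixes-transfer {i} {j} {k} iF jF kF h≢e Rji≡⟨h⟩ Rki≡⟨h⟩ k-fixes x y y' x∈ y∈ y→y' =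
    let z , z∈ = proj₁ kF
        x' , y'x'≡yx , x'z≡xz = transfer {β = x} (transpose (sym (k-fixes z y y' z∈ y∈ y→y'))) refl refl
        d , x→x' = T.connect i iF x∈ (trans (proj₁ (sameFibres x'z≡xz)) x∈)
    in trans (sym (transpose (j-fixes z∈ x→x' (transpose (sym x'z≡xz))))) (transpose y'x'≡yx)
    where
      -- x' = d x has the colour of x from z, so d ∈ R_ki = R_ji.
      j-fixes : ∀ {z x' d} → col z z ≡ k → col x x' ≡ φ i d → col z x ≡ col z x' →
                col y' x' ≡ col y' x
      j-fixes {d = d} z∈ x→x' zx≡zx' =
        R⇒Fixes (from (Rji≡⟨h⟩ d) (neighbourhood iF kF h≢e Rki≡⟨h⟩ z∈ x∈ x→x' zx≡zx'))
                y' x _ (T.target j jF y→y') x∈ x→x'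

  order2-propagates : ∀ {i j k h h'} → Reduced col φ → IsFiber col i → IsFiber col j →
                      IsFiber col k → k ≢ j → h ≢ e →
                      RIsOrd2 col φ j i h → RIsOrd2 col φ k i h → RIsOrd2 col φ i j h' →
                      RIsOrd2 col φ k j h'
  order2-propagates {j = j} {k = k} reduced iF jF kF k≢j h≢e Rji Rki Rij =
    RSubgroup.squeeze k j jF
      (λ g g∈R → to (Rij g) (Fixes⇒R jF (fixes-transfer iF jF kF h≢e Rji Rki (R⇒Fixes g∈R))))
      (reduced k j kF jF k≢j)

  moveBase : ∀ {i p h h'} → Reduced col φ → IsFiber col i → IsFiber col p → h ≢ e →
             RIsOrd2 col φ p i h → RIsOrd2 col φ i p h' →
             ∀ t → IsFiber col t → t ≡ i ⊎ RIsOrd2 col φ t i h → t ≡ p ⊎ RIsOrd2 col φ t p h'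
  moveBase reduced iF pF h≢e Rpi Rip t tF (inj₁ refl) = inj₂ Rip
  moveBase {p = p} reduced iF pF h≢e Rpi Rip t tF (inj₂ Rti) with t ≟ p
  ... | yes t≡p = inj₁ t≡p
  ... | no t≢p  = inj₂ (order2-propagates reduced iF pF tF t≢p h≢e Rpi Rti Rip)

  LineAt : Line col φ → Fin r → Set
  LineAt ℓ p = ∃[ hp ] (hp ≢ e ×
    (∀ t → IsFiber col t → OnLine col φ t ℓ ⇔ (t ≡ p ⊎ RIsOrd2 col φ t p hp)))

  lineAtBase : (ℓ : Line col φ) → LineAt ℓ (Line.base ℓ)
  lineAtBase ℓ = Line.gen ℓ , Line.gen≢e ℓ , λ t tF → mk⇔ id id

  lineAt : Reduced col φ → (ℓ : Line col φ) → ∀ p → IsFiber col p → OnLine col φ p ℓ → LineAt ℓ p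
  lineAt reduced ℓ p pF (inj₁ refl) = lineAtBase ℓ
  lineAt reduced ℓ p pF (inj₂ Rpi) = fromOtherPoint (p ≟ Line.base ℓ)
    where
      i = Line.base ℓ
      iF = Line.baseF ℓ
      fromOtherPoint : Dec (p ≡ i) → LineAt ℓ p
      fromOtherPoint (yes refl) = lineAtBase ℓ
      fromOtherPoint (no p≢i) =
        let h' , h'≢e , Rip = order2-transpose reduced iF pF (≢-sym p≢i) Rpi
        in h' , h'≢e , λ t tF → mk⇔ (moveBase reduced iF pF (Line.gen≢e ℓ) Rpi Rip t tF)
                                     (moveBase reduced pF iF h'≢e Rip Rpi t tF)

  sameLine : ∀ {ℓ ℓ' p} (at : LineAt ℓ p) (at' : LineAt ℓ' p) → proj₁ at ≡ proj₁ at' →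
             SameLine col φ ℓ ℓ'
  sameLine (h , _ , E) (_ , _ , E') refl t tF =
    mk⇔ (λ on → from (E' t tF) (to (E t tF) on)) (λ on' → from (E t tF) (to (E' t tF) on'))

  -- A point q ≠ p on L_p(H) determines H = R_qp, so p and q share at most one line.
  throughTwoPoints : ∀ {p q ℓ ℓ'} → IsFiber col q → p ≢ q → (at : LineAt ℓ p) (at' : LineAt ℓ' p) →
                     OnLine col φ q ℓ → OnLine col φ q ℓ' → SameLine col φ ℓ ℓ'
  throughTwoPoints {p} {q} {ℓ} {ℓ'} qF p≢q at at' qℓ qℓ' =
    sameBy (to (proj₂ (proj₂ at) q qF) qℓ) (to (proj₂ (proj₂ at') q qF) qℓ')
    where
      sameBy : q ≡ p ⊎ RIsOrd2 col φ q p (proj₁ at) → q ≡ p ⊎ RIsOrd2 col φ q p (proj₁ at') →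
               SameLine col φ ℓ ℓ'
      sameBy (inj₁ q≡p) _ = ⊥-elim (p≢q (sym q≡p))
      sameBy (inj₂ _) (inj₁ q≡p) = ⊥-elim (p≢q (sym q≡p))
      sameBy (inj₂ Rqp) (inj₂ Rqp') = sameLine {ℓ} {ℓ'} at at' (uniqueGenerator (proj₁ (proj₂ at')) Rqp Rqp')

  -- The lines through p are among L_p(H) for the three subgroups H of order 2.
  atMostThreeLines : ∀ {p} {ℓs : Fin 4 → Line col φ} → (∀ k → LineAt (ℓs k) p) →
                     ∃[ x ] ∃[ y ] (x ≢ y × SameLine col φ (ℓs x) (ℓs y))
  atMostThreeLines {ℓs = ℓs} at =
    let x , y , x≢y , same = repeatedNonIdentity (λ k → proj₁ (at k)) (λ k → proj₁ (proj₂ (at k)))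
    in x , y , x≢y , sameLine {ℓs x} {ℓs y} (at x) (at y) same

lemma4p3 : (n r : ℕ) (col : Fin n → Fin n → Fin r) (φ : Fin r → V4 → Fin r) →
    IsKleinConfiguration col → IsIdentification col φ → Reduced col φ →
    (∀ i → IsFiber col i → ∃[ j ] (IsFiber col j × j ≢ i × ¬ (∀ g → R col φ j i g))) →
    (∀ (ℓ : Line col φ) → ∃[ p ] ∃[ q ] (IsFiber col p × IsFiber col q × p ≢ q
        × OnLine col φ p ℓ × OnLine col φ q ℓ))
    × (∀ p q (ℓ ℓ' : Line col φ) → IsFiber col p → IsFiber col q → p ≢ q →
        OnLine col φ p ℓ → OnLine col φ q ℓ → OnLine col φ p ℓ' → OnLine col φ q ℓ' →
        SameLine col φ ℓ ℓ')
    × (∀ p → IsFiber col p → (ℓs : Fin 4 → Line col φ) → (∀ k → OnLine col φ p (ℓs k)) →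
        ∃[ x ] ∃[ y ] (x ≢ y × SameLine col φ (ℓs x) (ℓs y)))
lemma4p3 n r col φ K Id reduced _ = twoPoints , oneLine , threeLines
  where
    open Configuration (IsKleinConfiguration.coherent K) Id

    twoPoints : ∀ (ℓ : Line col φ) → ∃[ p ] ∃[ q ] (IsFiber col p × IsFiber col q × p ≢ q
                  × OnLine col φ p ℓ × OnLine col φ q ℓ)
    twoPoints ℓ =
      let j , jF , j≢i , Rji = Line.witness ℓ
      in Line.base ℓ , j , Line.baseF ℓ , jF , ≢-sym j≢i , inj₁ refl , inj₂ Rji

    oneLine : ∀ p q (ℓ ℓ' : Line col φ) → IsFiber col p → IsFiber col q → p ≢ q →
              OnLine col φ p ℓ → OnLine col φ q ℓ → OnLine col φ p ℓ' → OnLine col φ q ℓ' →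
              SameLine col φ ℓ ℓ'
    oneLine p q ℓ ℓ' pF qF p≢q pℓ qℓ pℓ' qℓ' =
      throughTwoPoints {ℓ = ℓ} {ℓ'} qF p≢q (lineAt reduced ℓ p pF pℓ) (lineAt reduced ℓ' p pF pℓ') qℓ qℓ'

    threeLines : ∀ p → IsFiber col p → (ℓs : Fin 4 → Line col φ) → (∀ k → OnLine col φ p (ℓs k)) →
                 ∃[ x ] ∃[ y ] (x ≢ y × SameLine col φ (ℓs x) (ℓs y))
    threeLines p pF ℓs on = atMostThreeLines {ℓs = ℓs} (λ k → lineAt reduced (ℓs k) p pF (on k))
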